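{- Let $G$ be a graph on $n$ vertices and let $N$ be an integer with $N\ge\max\{n,3\}$. If $G$ is isomorphic to an induced subgraph of some graph in $\mathcal{G}_{N+1}$, then there exists a graph $H\in\mathcal{G}_N$ such that $G$ is isomorphic to an induced subgraph of $H$.
   Context: All graphs are finite and simple. For an integer $m\ge 3$, $\mathcal{G}_m$ is the set consisting of the following eleven graphs: the $1$-subdivision of $K_{1,m}$ (obtained from the star $K_{1,m}$ by subdividing every edge once) and its complement; the line graph of $K_{2,m}$ and its complement; the thin spider with $m$ legs and its complement; the half-graph of height $m$; the graph $H'_{m,I}$; and the graph $H^*_m$ and its complement. Here: the thin spider with $m$ legs has vertices $v_1,\dots,v_m,u_1,\dots,u_m$ and edges $v_iu_i$ ($1\le i\le m$) and $u_iu_j$ ($1\le i<j\le m$). The half-graph of height $m$ has vertices $v_1,\dots,v_m,u_1,\dots,u_m$ and edges $v_iu_j$ for $1\le i\le j\le m$. $H'_{m,I}$ has vertices $v_1,\dots,v_m,u_1,\dots,u_m,w$ and edges $wv_i$ ($1\le i\le m$), $v_iu_j$ ($1\le i\le j\le m$), and $u_iu_j$ ($1\le i<j\le m$). $H^*_m$ has vertices $v_1,\dots,v_m,u_1,\dots,u_m,w$ and edges $wv_1$, $v_iu_j$ ($1\le i\le j\le m$), and $u_iu_j$ ($1\le i<j\le m$). The line graph of a graph $F$ has vertex set $E(F)$, two edges being adjacent when they share an end. -}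

module Defs where

open import Data.Nat using (ℕ; _≤ᵇ_; _≡ᵇ_)
open import Data.Fin using (Fin; toℕ)
import Data.Fin.Properties as FinP
open import Data.Bool using (Bool; true; false; _∧_; _∨_; not)
open import Data.Bool.Properties using (∨-comm; ∧-zeroʳ)
open import Data.Sum using (_⊎_; inj₁; inj₂)
import Data.Sum.Properties as SumP
open import Data.Unit using (⊤; tt)
import Data.Unit.Properties as UnitP
open import Data.Product using (Σ; _×_; _,_)
open import Data.Empty using (⊥-elim)
open import Relation.Nullary using (does; yes; no)
open import Relation.Binary.Definitions using (DecidableEquality)
open import Relation.Binary.PropositionalEquality using (_≡_; refl; sym; cong; cong₂)
open import Function.Definitions using (Injective)

record Graph (V : Set) : Set where
  field
    adj    : V → V → Bool
    adjSym : ∀ x y → adj x y ≡ adj y x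
    irrefl : ∀ x → adj x x ≡ false
open Graph public

private
  does-sym : ∀ {V : Set} (_≟_ : DecidableEquality V) (x y : V) →
             does (x ≟ y) ≡ does (y ≟ x)
  does-sym _≟_ x y with x ≟ y | y ≟ x
  ... | yes _ | yes _ = refl
  ... | no _  | no _  = refl
  ... | yes p | no q  = ⊥-elim (q (sym p))
  ... | no p  | yes q = ⊥-elim (p (sym q))

  does-refl : ∀ {V : Set} (_≟_ : DecidableEquality V) (x : V) →
              does (x ≟ x) ≡ true
  does-refl _≟_ x with x ≟ x
  ... | yes _ = refl
  ... | no p  = ⊥-elim (p refl)

fromRel : ∀ {V : Set} → DecidableEquality V → (V → V → Bool) → Graph V
fromRel _≟_ r = record
  { adj    = λ x y → (r x y ∨ r y x) ∧ not (does (x ≟ y))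
  ; adjSym = λ x y → cong₂ (λ a b → a ∧ not b) (∨-comm (r x y) (r y x)) (does-sym _≟_ x y)
  ; irrefl = λ x → helper x
  }
  where
  helper : ∀ x → (r x x ∨ r x x) ∧ not (does (x ≟ x)) ≡ false
  helper x rewrite does-refl _≟_ x = ∧-zeroʳ _

complement : ∀ {V : Set} → DecidableEquality V → Graph V → Graph V
complement _≟_ G = record
  { adj    = λ x y → not (adj G x y) ∧ not (does (x ≟ y))
  ; adjSym = λ x y → cong₂ (λ a b → not a ∧ not b) (adjSym G x y) (does-sym _≟_ x y)
  ; irrefl = λ x → helper x
  }
  where
  helper : ∀ x → not (adj G x x) ∧ not (does (x ≟ x)) ≡ false
  helper x rewrite does-refl _≟_ x = ∧-zeroʳ _

_↪_ : ∀ {V W : Set} → Graph V → Graph W → Set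
_↪_ {V} {W} G H =
  Σ (V → W) λ f → Injective _≡_ _≡_ f × (∀ x y → adj G x y ≡ adj H (f x) (f y))

-- Vertex sets.  Indices 1..m of the paper are Fin m = {0..m-1}.
-- VU m : inj₁ i = v_{i+1}, inj₂ i = u_{i+1}.
-- VUW m : inj₁ (inj₁ i) = v_{i+1}, inj₁ (inj₂ i) = u_{i+1}, inj₂ tt = w.

VU : ℕ → Set
VU m = Fin m ⊎ Fin m

VUW : ℕ → Set
VUW m = VU m ⊎ ⊤

_≟VU_ : ∀ {m} → DecidableEquality (VU m)
_≟VU_ = SumP.≡-dec FinP._≟_ FinP._≟_

_≟VUW_ : ∀ {m} → DecidableEquality (VUW m)
_≟VUW_ = SumP.≡-dec _≟VU_ UnitP._≟_

_=ᶠ_ : ∀ {m} → Fin m → Fin m → Bool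
i =ᶠ j = does (i FinP.≟ j)

_≤ᶠ_ : ∀ {m} → Fin m → Fin m → Bool
i ≤ᶠ j = toℕ i ≤ᵇ toℕ j

-- 1-subdivision of K_{1,m}: centre w, v_i subdivision vertices, u_i leaves;
-- edges w v_i and v_i u_i.
subdivRel : ∀ {m} → VUW m → VUW m → Bool
subdivRel (inj₂ tt) (inj₁ (inj₁ i)) = true
subdivRel (inj₁ (inj₁ i)) (inj₁ (inj₂ j)) = i =ᶠ j
subdivRel _ _ = false

subdivK1 : (m : ℕ) → Graph (VUW m)
subdivK1 m = fromRel _≟VUW_ subdivRel

-- Line graph of K_{2,m} with parts {a_1,a_2} and {b_1..b_m}:
-- inj₁ i is the edge a_1 b_{i+1}, inj₂ i is the edge a_2 b_{i+1};
-- two edges are adjacent iff they share an end.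
lineRel : ∀ {m} → VU m → VU m → Bool
lineRel (inj₁ i) (inj₁ j) = true   -- share a_1 (i ≠ j enforced by fromRel)
lineRel (inj₂ i) (inj₂ j) = true   -- share a_2
lineRel (inj₁ i) (inj₂ j) = i =ᶠ j -- share b_i
lineRel (inj₂ i) (inj₁ j) = i =ᶠ j

lineK2 : (m : ℕ) → Graph (VU m)
lineK2 m = fromRel _≟VU_ lineRel

spiderRel : ∀ {m} → VU m → VU m → Bool
spiderRel (inj₁ i) (inj₂ j) = i =ᶠ j
spiderRel (inj₂ i) (inj₂ j) = true
spiderRel _ _ = false

thinSpider : (m : ℕ) → Graph (VU m)
thinSpider m = fromRel _≟VU_ spiderRel

halfRel : ∀ {m} → VU m → VU m → Bool
halfRel (inj₁ i) (inj₂ j) = i ≤ᶠ j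
halfRel _ _ = false

halfGraph : (m : ℕ) → Graph (VU m)
halfGraph m = fromRel _≟VU_ halfRel

hIRel : ∀ {m} → VUW m → VUW m → Bool
hIRel (inj₂ tt) (inj₁ (inj₁ i)) = true
hIRel (inj₁ (inj₁ i)) (inj₁ (inj₂ j)) = i ≤ᶠ j
hIRel (inj₁ (inj₂ i)) (inj₁ (inj₂ j)) = true
hIRel _ _ = false

hPrimeI : (m : ℕ) → Graph (VUW m)
hPrimeI m = fromRel _≟VUW_ hIRel

hStarRel : ∀ {m} → VUW m → VUW m → Bool
hStarRel (inj₂ tt) (inj₁ (inj₁ i)) = toℕ i ≡ᵇ 0
hStarRel (inj₁ (inj₁ i)) (inj₁ (inj₂ j)) = i ≤ᶠ j
hStarRel (inj₁ (inj₂ i)) (inj₁ (inj₂ j)) = true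
hStarRel _ _ = false

hStar : (m : ℕ) → Graph (VUW m)
hStar m = fromRel _≟VUW_ hStarRel

data Kind : Set where
  subdiv subdivᶜ line lineᶜ spider spiderᶜ half hI star starᶜ : Kind


VK : Kind → ℕ → Set
VK subdiv  m = VUW m
VK subdivᶜ m = VUW m
VK line    m = VU m
VK lineᶜ   m = VU m
VK spider  m = VU m
VK spiderᶜ m = VU m
VK half    m = VU m
VK hI      m = VUW m
VK star    m = VUW m
VK starᶜ   m = VUW m

family : (k : Kind) (m : ℕ) → Graph (VK k m)
family subdiv  m = subdivK1 m
family subdivᶜ m = complement _≟VUW_ (subdivK1 m)
family line    m = lineK2 m
family lineᶜ   m = complement _≟VU_ (lineK2 m)
family spider  m = thinSpider m
family spiderᶜ m = complement _≟VU_ (thinSpider m)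
family half    m = halfGraph m
family hI      m = hPrimeI m
family star    m = hStar m
family starᶜ   m = complement _≟VUW_ (hStar m)

InducedInFamily : ∀ {V : Set} → Graph V → ℕ → Set
InducedInFamily G m = Σ Kind λ k → G ↪ family k m

{-# OPTIONS --safe #-}
module Submission where

-- A graph on n ≤ N vertices embedded in a member of 𝒢_{N+1} meets at most n of the N+1
-- index classes {v_i, u_i} (w joining the class of v_1), so some class r is unused.
-- Deleting it and renumbering the other indices order-preservingly turns the member of
-- 𝒢_{N+1} into the same member of 𝒢_N.  Every adjacency rule only compares indices for
-- equality or order, or tests for index 1, and that test only involves w, whose class is
-- not deleted; so the embedding survives.

open import Defs
open import Data.Nat using (ℕ; suc; _≤_)
open import Data.Fin using (Fin)

import Data.Nat as ℕ
import Data.Nat.Properties as ℕ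
open import Data.Fin using (zero; suc; toℕ; punchOut)
import Data.Fin.Properties as Fin
open import Data.Bool using (Bool; _∧_; _∨_; not)
open import Data.Sum using (inj₁; inj₂)
open import Data.Sum.Properties using (inj₁-injective; inj₂-injective)
open import Data.Unit using (tt)
open import Data.Product using (∃; _,_; proj₁; proj₂)
open import Function using (_∘_; mk⇔)
open import Relation.Nullary using (does; yes; no; contradiction)
open import Relation.Nullary.Decidable using (does-⇔)
open import Relation.Nullary.Recomputable using (¬-recompute)
open import Relation.Binary.Definitions using (DecidableEquality)
open import Relation.Binary.PropositionalEquality using (_≡_; _≢_; refl; sym; trans; cong; cong₂)

<⇒missesValue : ∀ {n m} → n ℕ.< m → (h : Fin n → Fin m) → ∃ λ r → ∀ x → r ≢ h x
<⇒missesValue {n} {m} n<m h with Fin.all? (λ r → Fin.any? (λ x → h x Fin.≟ r))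
... | no ¬allHit =
  let r , ¬hit = Fin.¬∀⟶∃¬ m _ (λ r → Fin.any? (λ x → h x Fin.≟ r)) ¬allHit
  in  r , λ x r≡hx → ¬hit (x , sym r≡hx)
... | yes allHit = contradiction (Fin.injective⇒≤ preimage-injective) (ℕ.<⇒≱ n<m)
  where
  preimage-injective : ∀ {r s} → proj₁ (allHit r) ≡ proj₁ (allHit s) → r ≡ s
  preimage-injective {r} {s} eq =
    trans (sym (proj₂ (allHit r))) (trans (cong h eq) (proj₂ (allHit s)))

PartialInjective : ∀ {V W : Set} {P : V → Set} → (∀ v → .(P v) → W) → Set
PartialInjective {P = P} ψ = ∀ v w .(p : P v) .(q : P w) → ψ v p ≡ ψ w q → v ≡ w

-- Irrelevant proofs of P make map v p independent of p, so map respects equality for free.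
record PartialEmbedding {V W : Set} (H : Graph V) (P : V → Set) (H′ : Graph W) : Set where
  field
    map       : ∀ v → .(P v) → W
    injective : PartialInjective map
    adj-≡     : ∀ v w .(p : P v) .(q : P w) → adj H v w ≡ adj H′ (map v p) (map w q)
open PartialEmbedding

partial-∘-↪ : ∀ {U V W : Set} {G : Graph U} {H : Graph V} {P : V → Set} {H′ : Graph W} →
  PartialEmbedding H P H′ → (f : G ↪ H) → (∀ x → P (proj₁ f x)) → G ↪ H′
partial-∘-↪ e (f , f-injective , f-adj) inP =
  (λ x → map e (f x) (inP x)) ,
  (λ {x} {y} eq → f-injective (injective e (f x) (f y) (inP x) (inP y) eq)) ,
  (λ x y → trans (f-adj x y) (adj-≡ e (f x) (f y) (inP x) (inP y)))

module _ {V W : Set} {P : V → Set} (_≟_ : DecidableEquality V) (_≟′_ : DecidableEquality W)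
         (ψ : ∀ v → .(P v) → W) (ψ-injective : PartialInjective ψ) where

  does-≟-preserved : ∀ v w .(p : P v) .(q : P w) → does (v ≟ w) ≡ does (ψ v p ≟′ ψ w q)
  does-≟-preserved v w p q =
    does-⇔ (mk⇔ (λ { refl → refl }) (ψ-injective v w p q)) (v ≟ w) (ψ v p ≟′ ψ w q)

  fromRel-partial : ∀ {R : V → V → Bool} {R′ : W → W → Bool} →
    (∀ v w .(p : P v) .(q : P w) → R v w ≡ R′ (ψ v p) (ψ w q)) →
    PartialEmbedding (fromRel _≟_ R) P (fromRel _≟′_ R′)
  fromRel-partial R-preserved = record
    { map       = ψ
    ; injective = ψ-injective
    ; adj-≡     = λ v w p q → cong₂ (λ a b → a ∧ not b)
                    (cong₂ _∨_ (R-preserved v w p q) (R-preserved w v q p))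
                    (does-≟-preserved v w p q)
    }

complement-partial : ∀ {V W : Set} {H : Graph V} {P : V → Set} {H′ : Graph W}
  (_≟_ : DecidableEquality V) (_≟′_ : DecidableEquality W) →
  PartialEmbedding H P H′ → PartialEmbedding (complement _≟_ H) P (complement _≟′_ H′)
complement-partial _≟_ _≟′_ e = record
  { map       = map e
  ; injective = injective e
  ; adj-≡     = λ v w p q → cong₂ (λ a b → not a ∧ not b)
                  (adj-≡ e v w p q) (does-≟-preserved _≟_ _≟′_ (map e) (injective e) v w p q)
  }

punchOut-isZero : ∀ {N} {r i : Fin (suc N)} (r≢i : r ≢ i) → r ≢ zero →
  (toℕ i ℕ.≡ᵇ 0) ≡ (toℕ (punchOut r≢i) ℕ.≡ᵇ 0)
punchOut-isZero {r = zero}                  _ r≢0 = contradiction refl r≢0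
punchOut-isZero {suc _} {r = suc _} {zero}  _ _   = refl
punchOut-isZero {suc _} {r = suc _} {suc _} _ _   = refl

indexVU : ∀ {N} → VU (suc N) → Fin (suc N)
indexVU (inj₁ i) = i
indexVU (inj₂ i) = i

indexVUW : ∀ {N} → VUW (suc N) → Fin (suc N)
indexVUW (inj₁ v)  = indexVU v
indexVUW (inj₂ tt) = zero

index : ∀ {N} (k : Kind) → VK k (suc N) → Fin (suc N)
index subdiv  = indexVUW
index subdivᶜ = indexVUW
index line    = indexVU
index lineᶜ   = indexVU
index spider  = indexVU
index spiderᶜ = indexVU
index half    = indexVU
index hI      = indexVUW
index star    = indexVUW
index starᶜ   = indexVUW

module DeleteIndex {N : ℕ} (r : Fin (suc N)) where

  delete : (i : Fin (suc N)) → .(r ≢ i) → Fin N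
  delete i r≢i = punchOut (¬-recompute r≢i)

  delete-injective : PartialInjective delete
  delete-injective _ _ p q = Fin.punchOut-injective (¬-recompute p) (¬-recompute q)

  delete-=ᶠ : ∀ i j .(p : r ≢ i) .(q : r ≢ j) → (i =ᶠ j) ≡ (delete i p =ᶠ delete j q)
  delete-=ᶠ = does-≟-preserved Fin._≟_ Fin._≟_ delete delete-injective

  delete-≤ᶠ : ∀ i j .(p : r ≢ i) .(q : r ≢ j) → (i ≤ᶠ j) ≡ (delete i p ≤ᶠ delete j q)
  delete-≤ᶠ i j p q = does-⇔  -- i ≤ᶠ j is definitionally does (i Fin.≤? j)
    (mk⇔ (Fin.punchOut-mono-≤ r≢i r≢j) (Fin.punchOut-cancel-≤ r≢i r≢j))
    (i Fin.≤? j) (delete i p Fin.≤? delete j q)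
    where
    r≢i : r ≢ i
    r≢i = ¬-recompute p
    r≢j : r ≢ j
    r≢j = ¬-recompute q

  delete-isZero : ∀ i .(p : r ≢ i) → .(r ≢ zero) →
    (toℕ i ℕ.≡ᵇ 0) ≡ (toℕ (delete i p) ℕ.≡ᵇ 0)
  delete-isZero i p r≢0 = punchOut-isZero (¬-recompute p) (¬-recompute r≢0)

  deleteVU : (v : VU (suc N)) → .(r ≢ indexVU v) → VU N
  deleteVU (inj₁ i) p = inj₁ (delete i p)
  deleteVU (inj₂ i) p = inj₂ (delete i p)

  deleteVUW : (v : VUW (suc N)) → .(r ≢ indexVUW v) → VUW N
  deleteVUW (inj₁ v)  p = inj₁ (deleteVU v p)
  deleteVUW (inj₂ tt) _ = inj₂ tt

  deleteVU-injective : PartialInjective deleteVU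
  deleteVU-injective (inj₁ i) (inj₁ j) p q eq =
    cong inj₁ (delete-injective i j p q (inj₁-injective eq))
  deleteVU-injective (inj₂ i) (inj₂ j) p q eq =
    cong inj₂ (delete-injective i j p q (inj₂-injective eq))

  deleteVUW-injective : PartialInjective deleteVUW
  deleteVUW-injective (inj₁ v)  (inj₁ w)  p q eq =
    cong inj₁ (deleteVU-injective v w p q (inj₁-injective eq))
  deleteVUW-injective (inj₂ tt) (inj₂ tt) _ _ _  = refl

  PreservedVU : (∀ {m} → VU m → VU m → Bool) → Set
  PreservedVU R = ∀ v w .(p : r ≢ indexVU v) .(q : r ≢ indexVU w) →
    R v w ≡ R (deleteVU v p) (deleteVU w q)

  PreservedVUW : (∀ {m} → VUW m → VUW m → Bool) → Set
  PreservedVUW R = ∀ v w .(p : r ≢ indexVUW v) .(q : r ≢ indexVUW w) →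
    R v w ≡ R (deleteVUW v p) (deleteVUW w q)

  lineRel-preserved : PreservedVU lineRel
  lineRel-preserved (inj₁ i) (inj₁ j) _ _ = refl
  lineRel-preserved (inj₁ i) (inj₂ j) p q = delete-=ᶠ i j p q
  lineRel-preserved (inj₂ i) (inj₁ j) p q = delete-=ᶠ i j p q
  lineRel-preserved (inj₂ i) (inj₂ j) _ _ = refl

  spiderRel-preserved : PreservedVU spiderRel
  spiderRel-preserved (inj₁ i) (inj₁ j) _ _ = refl
  spiderRel-preserved (inj₁ i) (inj₂ j) p q = delete-=ᶠ i j p q
  spiderRel-preserved (inj₂ i) (inj₁ j) _ _ = refl
  spiderRel-preserved (inj₂ i) (inj₂ j) _ _ = refl

  halfRel-preserved : PreservedVU halfRel
  halfRel-preserved (inj₁ i) (inj₁ j) _ _ = refl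
  halfRel-preserved (inj₁ i) (inj₂ j) p q = delete-≤ᶠ i j p q
  halfRel-preserved (inj₂ i) (inj₁ j) _ _ = refl
  halfRel-preserved (inj₂ i) (inj₂ j) _ _ = refl

  subdivRel-preserved : PreservedVUW subdivRel
  subdivRel-preserved (inj₁ (inj₁ i)) (inj₁ (inj₁ j)) _ _ = refl
  subdivRel-preserved (inj₁ (inj₁ i)) (inj₁ (inj₂ j)) p q = delete-=ᶠ i j p q
  subdivRel-preserved (inj₁ (inj₁ i)) (inj₂ tt)       _ _ = refl
  subdivRel-preserved (inj₁ (inj₂ i)) (inj₁ _)        _ _ = refl
  subdivRel-preserved (inj₁ (inj₂ i)) (inj₂ tt)       _ _ = refl
  subdivRel-preserved (inj₂ tt)       (inj₁ (inj₁ j)) _ _ = refl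
  subdivRel-preserved (inj₂ tt)       (inj₁ (inj₂ j)) _ _ = refl
  subdivRel-preserved (inj₂ tt)       (inj₂ tt)       _ _ = refl

  hIRel-preserved : PreservedVUW hIRel
  hIRel-preserved (inj₁ (inj₁ i)) (inj₁ (inj₁ j)) _ _ = refl
  hIRel-preserved (inj₁ (inj₁ i)) (inj₁ (inj₂ j)) p q = delete-≤ᶠ i j p q
  hIRel-preserved (inj₁ (inj₁ i)) (inj₂ tt)       _ _ = refl
  hIRel-preserved (inj₁ (inj₂ i)) (inj₁ (inj₁ j)) _ _ = refl
  hIRel-preserved (inj₁ (inj₂ i)) (inj₁ (inj₂ j)) _ _ = refl
  hIRel-preserved (inj₁ (inj₂ i)) (inj₂ tt)       _ _ = refl
  hIRel-preserved (inj₂ tt)       (inj₁ (inj₁ j)) _ _ = refl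
  hIRel-preserved (inj₂ tt)       (inj₁ (inj₂ j)) _ _ = refl
  hIRel-preserved (inj₂ tt)       (inj₂ tt)       _ _ = refl

  hStarRel-preserved : PreservedVUW hStarRel
  hStarRel-preserved (inj₁ (inj₁ i)) (inj₁ (inj₁ j)) _ _   = refl
  hStarRel-preserved (inj₁ (inj₁ i)) (inj₁ (inj₂ j)) p q   = delete-≤ᶠ i j p q
  hStarRel-preserved (inj₁ (inj₁ i)) (inj₂ tt)       _ _   = refl
  hStarRel-preserved (inj₁ (inj₂ i)) (inj₁ (inj₁ j)) _ _   = refl
  hStarRel-preserved (inj₁ (inj₂ i)) (inj₁ (inj₂ j)) _ _   = refl
  hStarRel-preserved (inj₁ (inj₂ i)) (inj₂ tt)       _ _   = refl
  hStarRel-preserved (inj₂ tt)       (inj₁ (inj₁ j)) r≢0 q = delete-isZero j q r≢0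
  hStarRel-preserved (inj₂ tt)       (inj₁ (inj₂ j)) _ _   = refl
  hStarRel-preserved (inj₂ tt)       (inj₂ tt)       _ _   = refl

  fromRelVU-partial : (R : ∀ {m} → VU m → VU m → Bool) → PreservedVU R →
    PartialEmbedding (fromRel _≟VU_ R) (λ v → r ≢ indexVU v) (fromRel _≟VU_ R)
  fromRelVU-partial _ = fromRel-partial _≟VU_ _≟VU_ deleteVU deleteVU-injective

  fromRelVUW-partial : (R : ∀ {m} → VUW m → VUW m → Bool) → PreservedVUW R →
    PartialEmbedding (fromRel _≟VUW_ R) (λ v → r ≢ indexVUW v) (fromRel _≟VUW_ R)
  fromRelVUW-partial _ = fromRel-partial _≟VUW_ _≟VUW_ deleteVUW deleteVUW-injective

  deleteIndex : (k : Kind) →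
    PartialEmbedding (family k (suc N)) (λ v → r ≢ index k v) (family k N)
  deleteIndex subdiv  = fromRelVUW-partial subdivRel subdivRel-preserved
  deleteIndex subdivᶜ = complement-partial _≟VUW_ _≟VUW_ (deleteIndex subdiv)
  deleteIndex line    = fromRelVU-partial lineRel lineRel-preserved
  deleteIndex lineᶜ   = complement-partial _≟VU_ _≟VU_ (deleteIndex line)
  deleteIndex spider  = fromRelVU-partial spiderRel spiderRel-preserved
  deleteIndex spiderᶜ = complement-partial _≟VU_ _≟VU_ (deleteIndex spider)
  deleteIndex half    = fromRelVU-partial halfRel halfRel-preserved
  deleteIndex hI      = fromRelVUW-partial hIRel hIRel-preserved
  deleteIndex star    = fromRelVUW-partial hStarRel hStarRel-preserved
  deleteIndex starᶜ   = complement-partial _≟VUW_ _≟VUW_ (deleteIndex star)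

open DeleteIndex using (deleteIndex)

lemma4p1 : (n N : ℕ) (G : Graph (Fin n)) → n ≤ N → 3 ≤ N →
    InducedInFamily G (suc N) → InducedInFamily G N
lemma4p1 n N G n≤N _ (k , f) =
  let r , r-unused = <⇒missesValue (ℕ.s≤s n≤N) (index {N} k ∘ proj₁ f)
  in  k , partial-∘-↪ {G = G} (deleteIndex r k) f r-unused
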